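{- Let $k \ge 2$ be an integer and let $G$ be a $k$-apex tree of order $n \ge 4k-1$. Then $G$ is not regular, i.e., not all vertices of $G$ have the same degree.
   Context: All graphs are simple, finite and connected. For $X \subset V(G)$, $G-X$ denotes the subgraph obtained from $G$ by deleting the vertices of $X$ and all edges incident with them. For an integer $k \ge 1$, a graph $G$ is called a $k$-apex tree if there exists a subset $X \subseteq V(G)$ with $|X| = k$ such that $G-X$ is a tree, and for every $Y \subset V(G)$ with $|Y| < k$, the graph $G-Y$ is not a tree. The order of $G$ is $|V(G)|$. A graph is regular if all its vertices have the same degree. -}

module Defs where

open import Data.Nat using (ℕ; zero; suc; _+_; _≤_; _<_)
open import Data.Bool using (Bool; true; false; if_then_else_)
open import Data.Fin using (Fin)
open import Data.Fin.Subset using (Subset; _∈_; _∉_; ∣_∣; ⁅_⁆)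
open import Data.List using (List; []; _∷_; length)
open import Data.List.Relation.Unary.All using (All)
open import Data.List.Relation.Unary.Unique.Propositional using (Unique)
open import Data.Vec.Functional using (Vector)
open import Data.Unit using (⊤)
open import Data.Product using (Σ; _×_; ∃; _,_)
open import Relation.Binary.PropositionalEquality using (_≡_)
open import Relation.Nullary using (¬_)
import Data.Vec.Functional as VF

record Graph (n : ℕ) : Set where
  field
    adj    : Fin n → Fin n → Bool
    adj-sym    : ∀ i j → adj i j ≡ adj j i
    adj-irrefl : ∀ i → adj i i ≡ false
open Graph public

Adj : ∀ {n} → Graph n → Fin n → Fin n → Set
Adj G i j = adj G i j ≡ true

Chain : ∀ {n} → Graph n → List (Fin n) → Set
Chain G []           = ⊤
Chain G (x ∷ [])     = ⊤
Chain G (x ∷ y ∷ xs) = Adj G x y × Chain G (y ∷ xs)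

data Last {A : Set} : List A → A → Set where
  last-here  : ∀ x → Last (x ∷ []) x
  last-there : ∀ {x xs y} → Last xs y → Last (x ∷ xs) y

WalkIn : ∀ {n} → Graph n → Subset n → Fin n → Fin n → Set
WalkIn {n} G S u v =
  Σ (List (Fin n)) λ w → Chain G (u ∷ w) × Last (u ∷ w) v × All (_∈ S) (u ∷ w)

ConnectedIn : ∀ {n} → Graph n → Subset n → Set
ConnectedIn {n} G S =
  (Σ (Fin n) λ v → v ∈ S) × (∀ u v → u ∈ S → v ∈ S → WalkIn G S u v)

CycleIn : ∀ {n} → Graph n → Subset n → List (Fin n) → Set
CycleIn G S [] = Data.Empty.⊥
  where import Data.Empty
CycleIn G S (x ∷ xs) =
  3 ≤ length (x ∷ xs) × Unique (x ∷ xs) × All (_∈ S) (x ∷ xs)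
  × Chain G (x ∷ xs) × Σ _ λ y → Last (x ∷ xs) y × Adj G y x

AcyclicIn : ∀ {n} → Graph n → Subset n → Set
AcyclicIn {n} G S = ∀ (c : List (Fin n)) → ¬ CycleIn G S c

TreeIn : ∀ {n} → Graph n → Subset n → Set
TreeIn G S = ConnectedIn G S × AcyclicIn G S

compl : ∀ {n} → Subset n → Subset n
compl = Data.Fin.Subset.∁

DeleteIsTree : ∀ {n} → Graph n → Subset n → Set
DeleteIsTree G X = TreeIn G (compl X)

Connected : ∀ {n} → Graph n → Set
Connected G = ConnectedIn G Data.Fin.Subset.⊤

IsKApexTree : ∀ {n} → ℕ → Graph n → Set
IsKApexTree {n} k G =
  (Σ (Subset n) λ X → ∣ X ∣ ≡ k × DeleteIsTree G X)
  × (∀ (Y : Subset n) → ∣ Y ∣ < k → ¬ DeleteIsTree G Y)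

degree : ∀ {n} → Graph n → Fin n → ℕ
degree G i = VF.foldr _+_ 0 (λ j → if adj G i j then 1 else 0)

Regular : ∀ {n} → Graph n → Set
Regular {n} G = ∀ (i j : Fin n) → degree G i ≡ degree G j

-- Let G be r-regular, X an apex set of size k and T = G - X the tree on m = n - k ≥ 3k - 1
-- vertices. Counting edge ends in T gives r m = 2 e(T) + e(T, X) ≤ 2 (m - 1) + r k, which is
-- impossible for r ≥ 3. A vertex a ∈ X adjacent to T cannot have exactly one neighbour in T,
-- for then X - a would be a smaller apex set; hence r = 2 and both edges of a go into T. Now
-- e(T, X) = 2 m - 2 e(T) = 2 is used up by a, yet connectivity gives another edge between
-- X - a and T.

module Submission where

open import Defs
open import Data.Nat using (ℕ; zero; suc; _+_; _*_; _∸_; _≤_; _<_; z≤n; s≤s; s≤s⁻¹)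
open import Data.Nat.Properties hiding (_≟_)
open import Data.Bool using (Bool; true; false; if_then_else_; not)
open import Data.Fin as Fin using (Fin)
open import Data.Fin.Properties using (_≟_; any?; injective⇒≤)
open import Data.Fin.Subset
  using (Subset; _∈_; _∉_; ∣_∣; ⁅_⁆; ∁; _∪_; _─_; _-_; _⊆_; Nonempty)
open import Data.Fin.Subset.Properties
  using (x∈⁅x⁆; x∈⁅y⁆⇒x≡y; x≢y⇒x∉⁅y⁆; x∈p∪q⁺; x∈p∪q⁻; x∈p∧x≢y⇒x∈p-y; p─q⊆p;
         ∣⁅x⁆∣≡1; nonempty?; p⊆q⇒∣p∣≤∣q∣; Empty-unique; ∣⊥∣≡0; ⊆-antisym; ∈⊤;
         _∈?_; x∉p⇒x∈∁p; x∈∁p⇒x∉p; ∣∁p∣≡n∸∣p∣; ∣p∣≤n)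
open import Data.Vec using ([]; _∷_; lookup) renaming (here to hereᵛ; there to thereᵛ)
open import Data.Vec.Properties using ([]=⇒lookup; lookup⇒[]=; lookup-map)
open import Data.Unit using (tt)
open import Data.Product using (∃; ∃₂; _×_; _,_; proj₁; proj₂)
open import Data.Sum as Sum using (_⊎_; inj₁; inj₂; [_,_])
open import Data.Empty using (⊥; ⊥-elim)
open import Function using (_∘_)
open import Function.Definitions using (Injective)
open import Data.List as List using (List; []; _∷_; _++_; length)
open import Data.List.Relation.Unary.All as All using (All; []; _∷_)
import Data.List.Relation.Unary.All.Properties as All
open import Data.List.Relation.Unary.Any using (here; there)
import Data.List.Relation.Unary.Any as Any
open import Data.List.Relation.Unary.AllPairs using ([]; _∷_)
open import Data.List.Relation.Unary.Unique.Propositional using (Unique)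
open import Data.List.Membership.Propositional using () renaming (_∈_ to _∈ˡ_)
open import Data.List.Membership.Propositional.Properties using (∈-lookup; ∈-∃++)
import Data.List.Properties as List
import Data.List.Relation.Unary.Unique.Propositional.Properties as Unique
open import Data.List.Relation.Binary.Disjoint.Propositional using (Disjoint)
open import Data.Nat.Tactic.RingSolver using (solve-∀)
open import Relation.Nullary using (¬_; ¬?; yes; no; contradiction; _×-dec_)
open import Relation.Binary.PropositionalEquality hiding ([_])
open import Algebra.Properties.Semiring.Sum +-*-semiring
  using (sum; sum-cong-≗; ∑-distrib-+; ∑-comm; *-distribˡ-sum; *-distribʳ-sum)

private
  variable
    n : ℕ

-- Indicators and finite sums

χ : Bool → ℕ
χ b = if b then 1 else 0

χ≤1 : ∀ b → χ b ≤ 1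
χ≤1 true  = ≤-refl
χ≤1 false = z≤n

χ-*-≤ : ∀ b x → χ b * x ≤ x
χ-*-≤ b x = ≤-trans (*-monoˡ-≤ x (χ≤1 b)) (≤-reflexive (*-identityˡ x))

sum-mono-≤ : {f g : Fin n → ℕ} → (∀ i → f i ≤ g i) → sum f ≤ sum g
sum-mono-≤ {zero}  f≤g = z≤n
sum-mono-≤ {suc n} f≤g = +-mono-≤ (f≤g Fin.zero) (sum-mono-≤ (f≤g ∘ Fin.suc))

sum-zero : {f : Fin n → ℕ} → (∀ i → f i ≡ 0) → sum f ≡ 0
sum-zero {zero}  f≡0 = refl
sum-zero {suc n} f≡0 = cong₂ _+_ (f≡0 Fin.zero) (sum-zero (f≡0 ∘ Fin.suc))

𝟙 : Subset n → Fin n → ℕ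
𝟙 S i = χ (lookup S i)

𝟙-∈ : {S : Subset n} {i : Fin n} → i ∈ S → 𝟙 S i ≡ 1
𝟙-∈ i∈S rewrite []=⇒lookup i∈S = refl

𝟙-∉ : {S : Subset n} {i : Fin n} → i ∉ S → 𝟙 S i ≡ 0
𝟙-∉ {S = S} {i} i∉S with lookup S i in eq
... | true  = contradiction (lookup⇒[]= i S eq) i∉S
... | false = refl

𝟙≤1 : (S : Subset n) (i : Fin n) → 𝟙 S i ≤ 1
𝟙≤1 S i = χ≤1 (lookup S i)

𝟙-mono : {S S′ : Subset n} → S ⊆ S′ → ∀ i → 𝟙 S i ≤ 𝟙 S′ i
𝟙-mono {S = S} S⊆S′ i with lookup S i in eq
... | true  = ≤-reflexive (sym (𝟙-∈ (S⊆S′ (lookup⇒[]= i S eq))))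
... | false = z≤n

𝟙-∁ : (S : Subset n) (i : Fin n) → 𝟙 (∁ S) i + 𝟙 S i ≡ 1
𝟙-∁ S i rewrite lookup-map i not S with lookup S i
... | true  = refl
... | false = refl

∣∣≡sum𝟙 : (S : Subset n) → ∣ S ∣ ≡ sum (𝟙 S)
∣∣≡sum𝟙 []           = refl
∣∣≡sum𝟙 (true  ∷ S) = cong suc (∣∣≡sum𝟙 S)
∣∣≡sum𝟙 (false ∷ S) = ∣∣≡sum𝟙 S

sum𝟙⁅⁆ : (p : Fin n) → sum (𝟙 ⁅ p ⁆) ≡ 1
sum𝟙⁅⁆ p = trans (sym (∣∣≡sum𝟙 ⁅ p ⁆)) (∣⁅x⁆∣≡1 p)

𝟙⁅⁆-* : (p : Fin n) (f : Fin n → ℕ) (i : Fin n) → 𝟙 ⁅ p ⁆ i * f i ≡ 𝟙 ⁅ p ⁆ i * f p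
𝟙⁅⁆-* p f i with i ≟ p
... | yes refl = refl
... | no  i≢p  rewrite 𝟙-∉ (x≢y⇒x∉⁅y⁆ i≢p) = refl

sum-𝟙⁅⁆-* : (p : Fin n) (f : Fin n → ℕ) → sum (λ i → 𝟙 ⁅ p ⁆ i * f i) ≡ f p
sum-𝟙⁅⁆-* p f = begin
  sum (λ i → 𝟙 ⁅ p ⁆ i * f i)  ≡⟨ sum-cong-≗ (𝟙⁅⁆-* p f) ⟩
  sum (λ i → 𝟙 ⁅ p ⁆ i * f p)  ≡⟨ *-distribʳ-sum (f p) (𝟙 ⁅ p ⁆) ⟨
  sum (𝟙 ⁅ p ⁆) * f p          ≡⟨ cong (_* f p) (sum𝟙⁅⁆ p) ⟩
  1 * f p                       ≡⟨ *-identityˡ (f p) ⟩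
  f p                           ∎
  where open ≡-Reasoning

𝟙-*-≤ : (S : Subset n) (i : Fin n) (x : ℕ) → 𝟙 S i * x ≤ x
𝟙-*-≤ S i x = χ-*-≤ (lookup S i) x

sum𝟙-* : (S : Subset n) (c : ℕ) → sum (λ i → 𝟙 S i * c) ≡ c * ∣ S ∣
sum𝟙-* S c = begin
  sum (λ i → 𝟙 S i * c)  ≡⟨ *-distribʳ-sum c (𝟙 S) ⟨
  sum (𝟙 S) * c          ≡⟨ cong (_* c) (∣∣≡sum𝟙 S) ⟨
  ∣ S ∣ * c              ≡⟨ *-comm ∣ S ∣ c ⟩
  c * ∣ S ∣              ∎
  where open ≡-Reasoning

≤-sum : (f : Fin n → ℕ) (i : Fin n) → f i ≤ sum f
≤-sum f i = begin
  f i                          ≡⟨ sum-𝟙⁅⁆-* i f ⟨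
  sum (λ j → 𝟙 ⁅ i ⁆ j * f j)  ≤⟨ sum-mono-≤ (λ j → 𝟙-*-≤ ⁅ i ⁆ j (f j)) ⟩
  sum f                        ∎
  where open ≤-Reasoning

+-≤-sum : (f : Fin n → ℕ) {i j : Fin n} → i ≢ j → f i + f j ≤ sum f
+-≤-sum {n} f {i} {j} i≢j = begin
  f i + f j                    ≡⟨ cong₂ _+_ (sum-𝟙⁅⁆-* i f) (sum-𝟙⁅⁆-* j f) ⟨
  sum (at i) + sum (at j)      ≡⟨ ∑-distrib-+ (at i) (at j) ⟨
  sum (λ l → at i l + at j l)  ≤⟨ sum-mono-≤ atMostOnce ⟩
  sum f                        ∎
  where
  open ≤-Reasoning
  at : Fin n → Fin n → ℕ
  at p l = 𝟙 ⁅ p ⁆ l * f l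
  atMostOnce : ∀ l → at i l + at j l ≤ f l
  atMostOnce l with l ≟ i
  ... | yes refl rewrite 𝟙-∉ (x≢y⇒x∉⁅y⁆ i≢j) =
    ≤-trans (≤-reflexive (+-identityʳ (at l l))) (𝟙-*-≤ ⁅ l ⁆ l (f l))
  ... | no  l≢i  rewrite 𝟙-∉ (x≢y⇒x∉⁅y⁆ l≢i) = 𝟙-*-≤ ⁅ j ⁆ l (f l)

∃-support : (f : Fin n → ℕ) → 1 ≤ sum f → ∃ λ i → 1 ≤ f i
∃-support f 1≤∑f with any? (λ i → 1 ≤? f i)
... | yes found = found
... | no  none  = contradiction (sum-zero λ i → n<1⇒n≡0 (≰⇒> (none ∘ (i ,_)))) (m<n⇒n≢0 1≤∑f)

∃-≢-support : (f : Fin n → ℕ) → (∀ i → f i ≤ 1) → 2 ≤ sum f →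
              (p : Fin n) → ∃ λ i → i ≢ p × 1 ≤ f i
∃-≢-support f f≤1 2≤∑f p with any? (λ i → ¬? (i ≟ p) ×-dec 1 ≤? f i)
... | yes found = found
... | no  none  = contradiction (≤-trans 2≤∑f ∑f≤1) λ { (s≤s ()) }
  where
  f≤𝟙⁅p⁆ : ∀ i → f i ≤ 𝟙 ⁅ p ⁆ i
  f≤𝟙⁅p⁆ i with i ≟ p
  ... | yes refl = subst (f i ≤_) (sym (𝟙-∈ (x∈⁅x⁆ i))) (f≤1 i)
  ... | no  i≢p  rewrite 𝟙-∉ (x≢y⇒x∉⁅y⁆ i≢p) = ≤-reflexive (n<1⇒n≡0 (≰⇒> λ 1≤fi → none (i , i≢p , 1≤fi)))
  ∑f≤1 : sum f ≤ 1
  ∑f≤1 = ≤-trans (sum-mono-≤ f≤𝟙⁅p⁆) (≤-reflexive (sum𝟙⁅⁆ p))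

x∈p─q⇒x∉q : {x : Fin n} (p q : Subset n) → x ∈ p ─ q → x ∉ q
x∈p─q⇒x∉q (_ ∷ _) (_ ∷ _) ()          hereᵛ
x∈p─q⇒x∉q (_ ∷ p) (_ ∷ q) (thereᵛ x∈) (thereᵛ x∈q) = x∈p─q⇒x∉q p q x∈ x∈q

∣∁p∣+∣p∣≡n : (p : Subset n) → ∣ ∁ p ∣ + ∣ p ∣ ≡ n
∣∁p∣+∣p∣≡n {n} p = trans (cong (_+ ∣ p ∣) (∣∁p∣≡n∸∣p∣ p)) (m∸n+n≡m (∣p∣≤n p))

x∉p-x : (p : Subset n) (x : Fin n) → x ∉ p - x
x∉p-x p x x∈p-x = x∈p─q⇒x∉q p ⁅ x ⁆ x∈p-x (x∈⁅x⁆ x)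

∈∪⁅⁆⁻ : {x y : Fin n} (p : Subset n) → x ∈ p ∪ ⁅ y ⁆ → x ∈ p ⊎ x ≡ y
∈∪⁅⁆⁻ {y = y} p x∈ = Sum.map₂ (x∈⁅y⁆⇒x≡y y) (x∈p∪q⁻ p ⁅ y ⁆ x∈)

p-x∪⁅x⁆≡p : {p : Subset n} {x : Fin n} → x ∈ p → (p - x) ∪ ⁅ x ⁆ ≡ p
p-x∪⁅x⁆≡p {p = p} {x} x∈p = ⊆-antisym ⊆p p⊆
  where
  ⊆p : (p - x) ∪ ⁅ x ⁆ ⊆ p
  ⊆p i∈ with ∈∪⁅⁆⁻ (p - x) i∈
  ... | inj₁ i∈p-x = p─q⊆p p ⁅ x ⁆ i∈p-x
  ... | inj₂ refl  = x∈p
  p⊆ : p ⊆ (p - x) ∪ ⁅ x ⁆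
  p⊆ {i} i∈p with i ≟ x
  ... | yes refl = x∈p∪q⁺ (inj₂ (x∈⁅x⁆ i))
  ... | no  i≢x  = x∈p∪q⁺ (inj₁ (x∈p∧x≢y⇒x∈p-y i∈p i≢x))

∁[p-x]≡∁p∪⁅x⁆ : (p : Subset n) (x : Fin n) → ∁ (p - x) ≡ ∁ p ∪ ⁅ x ⁆
∁[p-x]≡∁p∪⁅x⁆ p x = ⊆-antisym ⊆∪ ∪⊆
  where
  ⊆∪ : ∁ (p - x) ⊆ ∁ p ∪ ⁅ x ⁆
  ⊆∪ {i} i∈ with i ≟ x
  ... | yes refl = x∈p∪q⁺ (inj₂ (x∈⁅x⁆ i))
  ... | no  i≢x  = x∈p∪q⁺ (inj₁ (x∉p⇒x∈∁p (x∈∁p⇒x∉p i∈ ∘ λ i∈p → x∈p∧x≢y⇒x∈p-y i∈p i≢x)))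
  ∪⊆ : ∁ p ∪ ⁅ x ⁆ ⊆ ∁ (p - x)
  ∪⊆ i∈ with ∈∪⁅⁆⁻ (∁ p) i∈
  ... | inj₁ i∈∁p = x∉p⇒x∈∁p (x∈∁p⇒x∉p i∈∁p ∘ p─q⊆p p ⁅ x ⁆)
  ... | inj₂ refl = x∉p⇒x∈∁p (x∉p-x p x)

𝟙-∪⁅⁆ : {S : Subset n} {u : Fin n} → u ∉ S → ∀ i → 𝟙 (S ∪ ⁅ u ⁆) i ≡ 𝟙 S i + 𝟙 ⁅ u ⁆ i
𝟙-∪⁅⁆ {S = S} {u} u∉S i with i ≟ u | i ∈? S
... | yes refl | _
  rewrite 𝟙-∈ (x∈p∪q⁺ {p = S} (inj₂ (x∈⁅x⁆ i))) | 𝟙-∉ u∉S | 𝟙-∈ (x∈⁅x⁆ i) = refl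
... | no  i≢u  | yes i∈S
  rewrite 𝟙-∈ (x∈p∪q⁺ {q = ⁅ u ⁆} (inj₁ i∈S)) | 𝟙-∈ i∈S | 𝟙-∉ (x≢y⇒x∉⁅y⁆ i≢u) = refl
... | no  i≢u  | no  i∉S
  rewrite 𝟙-∉ ([ i∉S , i≢u ] ∘ ∈∪⁅⁆⁻ S) | 𝟙-∉ i∉S | 𝟙-∉ (x≢y⇒x∉⁅y⁆ i≢u) = refl

∣∪⁅⁆∣ : {S : Subset n} {u : Fin n} → u ∉ S → ∣ S ∪ ⁅ u ⁆ ∣ ≡ suc ∣ S ∣
∣∪⁅⁆∣ {S = S} {u} u∉S = begin
  ∣ S ∪ ⁅ u ⁆ ∣                  ≡⟨ ∣∣≡sum𝟙 (S ∪ ⁅ u ⁆) ⟩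
  sum (𝟙 (S ∪ ⁅ u ⁆))            ≡⟨ sum-cong-≗ (𝟙-∪⁅⁆ u∉S) ⟩
  sum (λ i → 𝟙 S i + 𝟙 ⁅ u ⁆ i)  ≡⟨ ∑-distrib-+ (𝟙 S) (𝟙 ⁅ u ⁆) ⟩
  sum (𝟙 S) + sum (𝟙 ⁅ u ⁆)      ≡⟨ cong₂ _+_ (sym (∣∣≡sum𝟙 S)) (sum𝟙⁅⁆ u) ⟩
  ∣ S ∣ + 1                      ≡⟨ +-comm ∣ S ∣ 1 ⟩
  suc ∣ S ∣                      ∎
  where open ≡-Reasoning

suc∣p-x∣≡∣p∣ : {p : Subset n} {x : Fin n} → x ∈ p → suc ∣ p - x ∣ ≡ ∣ p ∣
suc∣p-x∣≡∣p∣ {p = p} {x} x∈p = trans (sym (∣∪⁅⁆∣ (x∉p-x p x))) (cong ∣_∣ (p-x∪⁅x⁆≡p x∈p))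

nonempty : {p : Subset n} → 1 ≤ ∣ p ∣ → Nonempty p
nonempty {n} {p} 1≤∣p∣ with nonempty? p
... | yes p≢∅ = p≢∅
... | no  p≡∅ = contradiction (trans (cong ∣_∣ (Empty-unique p≡∅)) (∣⊥∣≡0 n)) (m<n⇒n≢0 1≤∣p∣)

lookup-injective : {A : Set} {xs : List A} → Unique xs → Injective _≡_ _≡_ (List.lookup xs)
lookup-injective (_  ∷ _) {Fin.zero}  {Fin.zero}  _  = refl
lookup-injective (x∉ ∷ _) {Fin.zero}  {Fin.suc j} eq = ⊥-elim (All.lookup x∉ (∈-lookup j) eq)
lookup-injective (x∉ ∷ _) {Fin.suc i} {Fin.zero}  eq = ⊥-elim (All.lookup x∉ (∈-lookup i) (sym eq))
lookup-injective (_  ∷ u) {Fin.suc i} {Fin.suc j} eq = cong Fin.suc (lookup-injective u eq)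

Unique⇒length≤ : {xs : List (Fin n)} → Unique xs → length xs ≤ n
Unique⇒length≤ u = injective⇒≤ (lookup-injective u)

module _ {A : Set} where

  prefix : {x : A} {xs : List A} → x ∈ˡ xs → List A
  prefix {xs = y ∷ _} (here _)  = y ∷ []
  prefix {xs = y ∷ _} (there q) = y ∷ prefix q

  Last-prefix : {x : A} {xs : List A} (q : x ∈ˡ xs) → Last (prefix q) x
  Last-prefix (here refl) = last-here _
  Last-prefix (there q)   = last-there (Last-prefix q)

  All-prefix : {P : A → Set} {x : A} {xs : List A} (q : x ∈ˡ xs) → All P xs → All P (prefix q)
  All-prefix (here _)  (px ∷ _)   = px ∷ []
  All-prefix (there q) (px ∷ pxs) = px ∷ All-prefix q pxs

  Unique-prefix : {x : A} {xs : List A} (q : x ∈ˡ xs) → Unique xs → Unique (prefix q)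
  Unique-prefix (here _)  (_ ∷ _)    = [] ∷ []
  Unique-prefix (there q) (y∉ ∷ u)   = All-prefix q y∉ ∷ Unique-prefix q u

  1≤length-prefix : {x : A} {xs : List A} (q : x ∈ˡ xs) → 1 ≤ length (prefix q)
  1≤length-prefix (here _)  = s≤s z≤n
  1≤length-prefix (there _) = s≤s z≤n

  Last-snoc : (x : A) (xs : List A) (y : A) → Last (x ∷ xs ++ y ∷ []) y
  Last-snoc x []       y = last-there (last-here y)
  Last-snoc x (z ∷ xs) y = last-there (Last-snoc z xs y)

  Last-tail : {x y z : A} {xs : List A} → Last (x ∷ y ∷ xs) z → Last (y ∷ xs) z
  Last-tail (last-there l) = l

  Last⇒∈ : {xs : List A} {y : A} → Last xs y → y ∈ˡ xs
  Last⇒∈ (last-here _)  = here refl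
  Last⇒∈ (last-there l) = there (Last⇒∈ l)

leaf-removal-bound : ∀ m {x d} → x ≤ 2 * m ∸ 2 → d ≤ 1 → d ≤ m → x + 2 * d ≤ 2 * suc m ∸ 2
leaf-removal-bound zero    {x} x≤0 _ z≤n = ≤-trans (≤-reflexive (+-identityʳ x)) x≤0
leaf-removal-bound (suc m) {x} {d} x≤ d≤1 _ = begin
  x + 2 * d             ≤⟨ +-mono-≤ x≤ (*-monoʳ-≤ 2 d≤1) ⟩
  2 * suc m ∸ 2 + 2     ≡⟨ m∸n+n≡m (*-monoʳ-≤ 2 (s≤s z≤n)) ⟩
  2 * suc m             ≡⟨ cong (_∸ 2) (*-suc 2 (suc m)) ⟨
  2 * suc (suc m) ∸ 2   ∎
  where open ≤-Reasoning

-- With r = 3 + s, k = 2 + j and m = 5 + 3j + e, the left side exceeds the right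
-- by 1 + e + s (3 + 2j + e).
regular-count-impossible : {r k m : ℕ} → 3 ≤ r → 2 ≤ k → 4 * k ∸ 1 ≤ m + k →
                           ¬ (r * m ≤ 2 * m ∸ 2 + r * k)
regular-count-impossible {m = m} (s≤s (s≤s (s≤s {n = s} _))) (s≤s (s≤s {n = j} _)) bound count =
  m+1+n≰m rhs (subst (_≤ rhs) (excess s j e) count′)
  where
  5+3j≤m : 5 + 3 * j ≤ m
  5+3j≤m = +-cancelʳ-≤ (2 + j) (5 + 3 * j) m (subst (_≤ m + (2 + j)) (cong (_∸ 1) (split j)) bound)
    where
    split : ∀ j → 4 * (2 + j) ≡ 1 + ((5 + 3 * j) + (2 + j))
    split = solve-∀
  e : ℕ
  e = proj₁ (m≤n⇒∃[o]m+o≡n 5+3j≤m)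
  rhs : ℕ
  rhs = 8 + 6 * j + 2 * e + (3 + s) * (2 + j)
  twice : 2 * (5 + 3 * j + e) ∸ 2 ≡ 8 + 6 * j + 2 * e
  twice = cong (_∸ 2) (double j e)
    where
    double : ∀ j e → 2 * (5 + 3 * j + e) ≡ 2 + (8 + 6 * j + 2 * e)
    double = solve-∀
  count′ : (3 + s) * (5 + 3 * j + e) ≤ rhs
  count′ = ≤-trans (subst (λ x → (3 + s) * x ≤ 2 * x ∸ 2 + (3 + s) * (2 + j))
                           (sym (proj₂ (m≤n⇒∃[o]m+o≡n 5+3j≤m))) count)
                   (≤-reflexive (cong (_+ (3 + s) * (2 + j)) twice))
  excess : ∀ s j e → (3 + s) * (5 + 3 * j + e) ≡
                     8 + 6 * j + 2 * e + (3 + s) * (2 + j) + suc (e + s * (3 + 2 * j + e))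
  excess = solve-∀

-- Adjacency counts

module _ (G : Graph n) where

  -- With A the adjacency matrix, neighbourSum w = A w and adjForm u w = uᵀ A w.

  χadj : Fin n → Fin n → ℕ
  χadj i j = χ (adj G i j)

  neighbourSum : (Fin n → ℕ) → Fin n → ℕ
  neighbourSum w v = sum λ j → χadj v j * w j

  adjForm : (Fin n → ℕ) → (Fin n → ℕ) → ℕ
  adjForm u w = sum λ i → u i * neighbourSum w i

  χadj-sym : ∀ i j → χadj i j ≡ χadj j i
  χadj-sym i j = cong χ (adj-sym G i j)

  neighbourSum-cong : {w w′ : Fin n → ℕ} → (∀ j → w j ≡ w′ j) →
                      ∀ v → neighbourSum w v ≡ neighbourSum w′ v
  neighbourSum-cong w≗w′ v = sum-cong-≗ λ j → cong (χadj v j *_) (w≗w′ j)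

  neighbourSum-mono : {w w′ : Fin n → ℕ} → (∀ j → w j ≤ w′ j) →
                      ∀ v → neighbourSum w v ≤ neighbourSum w′ v
  neighbourSum-mono w≤w′ v = sum-mono-≤ λ j → *-monoʳ-≤ (χadj v j) (w≤w′ j)

  neighbourSum≤sum : (w : Fin n → ℕ) (v : Fin n) → neighbourSum w v ≤ sum w
  neighbourSum≤sum w v = sum-mono-≤ λ j → χ-*-≤ (adj G v j) (w j)

  neighbourSum-+ : (u w : Fin n → ℕ) (v : Fin n) →
                   neighbourSum (λ j → u j + w j) v ≡ neighbourSum u v + neighbourSum w v
  neighbourSum-+ u w v = trans (sum-cong-≗ λ j → *-distribˡ-+ (χadj v j) (u j) (w j))
                               (∑-distrib-+ (λ j → χadj v j * u j) (λ j → χadj v j * w j))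

  neighbourSum-𝟙⁅⁆ : (u v : Fin n) → neighbourSum (𝟙 ⁅ u ⁆) v ≡ χadj v u
  neighbourSum-𝟙⁅⁆ u v = trans (sum-cong-≗ λ j → *-comm (χadj v j) (𝟙 ⁅ u ⁆ j))
                               (sum-𝟙⁅⁆-* u (χadj v))

  adjForm-comm : (u w : Fin n → ℕ) → adjForm u w ≡ adjForm w u
  adjForm-comm u w = begin
    sum (λ i → u i * sum (λ j → χadj i j * w j))
      ≡⟨ sum-cong-≗ (λ i → *-distribˡ-sum (u i) (λ j → χadj i j * w j)) ⟩
    sum (λ i → sum (λ j → u i * (χadj i j * w j)))
      ≡⟨ ∑-comm (λ i j → u i * (χadj i j * w j)) ⟩
    sum (λ j → sum (λ i → u i * (χadj i j * w j)))
      ≡⟨ sum-cong-≗ (λ j → sum-cong-≗ (λ i → swap i j)) ⟩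
    sum (λ j → sum (λ i → w j * (χadj j i * u i)))
      ≡⟨ sum-cong-≗ (λ j → *-distribˡ-sum (w j) (λ i → χadj j i * u i)) ⟨
    sum (λ j → w j * sum (λ i → χadj j i * u i))
      ∎
    where
    open ≡-Reasoning
    swap : ∀ i j → u i * (χadj i j * w j) ≡ w j * (χadj j i * u i)
    swap i j = trans (outer (u i) (χadj i j) (w j)) (cong (λ a → w j * (a * u i)) (χadj-sym i j))
      where
      outer : ∀ x a y → x * (a * y) ≡ y * (a * x)
      outer = solve-∀

  adjForm-cong : {w w′ : Fin n → ℕ} → (∀ j → w j ≡ w′ j) → adjForm w w ≡ adjForm w′ w′
  adjForm-cong w≗w′ = sum-cong-≗ λ i → cong₂ _*_ (w≗w′ i) (neighbourSum-cong w≗w′ i)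

  adjForm-mono : {u u′ w w′ : Fin n → ℕ} → (∀ i → u i ≤ u′ i) → (∀ j → w j ≤ w′ j) →
                 adjForm u w ≤ adjForm u′ w′
  adjForm-mono u≤u′ w≤w′ = sum-mono-≤ λ i → *-mono-≤ (u≤u′ i) (neighbourSum-mono w≤w′ i)

  adjForm-+ˡ : (u u′ w : Fin n → ℕ) → adjForm (λ i → u i + u′ i) w ≡ adjForm u w + adjForm u′ w
  adjForm-+ˡ u u′ w = trans (sum-cong-≗ λ i → *-distribʳ-+ (neighbourSum w i) (u i) (u′ i))
                            (∑-distrib-+ (λ i → u i * neighbourSum w i) (λ i → u′ i * neighbourSum w i))

  adjForm-+ʳ : (u w w′ : Fin n → ℕ) → adjForm u (λ j → w j + w′ j) ≡ adjForm u w + adjForm u w′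
  adjForm-+ʳ u w w′ = begin
    adjForm u (λ j → w j + w′ j)  ≡⟨ adjForm-comm u _ ⟩
    adjForm (λ j → w j + w′ j) u  ≡⟨ adjForm-+ˡ w w′ u ⟩
    adjForm w u + adjForm w′ u    ≡⟨ cong₂ _+_ (adjForm-comm w u) (adjForm-comm w′ u) ⟩
    adjForm u w + adjForm u w′    ∎
    where open ≡-Reasoning

  adjForm-𝟙⁅⁆ : (u : Fin n) (w : Fin n → ℕ) → adjForm (𝟙 ⁅ u ⁆) w ≡ neighbourSum w u
  adjForm-𝟙⁅⁆ u w = sum-𝟙⁅⁆-* u (neighbourSum w)

  adjForm-+𝟙⁅⁆ : (w : Fin n → ℕ) (u : Fin n) →
                 let w⁺ = λ i → w i + 𝟙 ⁅ u ⁆ i in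
                 adjForm w⁺ w⁺ ≡ adjForm w w + 2 * neighbourSum w u
  adjForm-+𝟙⁅⁆ w u = begin
    adjForm w⁺ w⁺
      ≡⟨ adjForm-+ˡ w δ w⁺ ⟩
    adjForm w w⁺ + adjForm δ w⁺
      ≡⟨ cong₂ _+_ (adjForm-+ʳ w w δ) (adjForm-+ʳ δ w δ) ⟩
    (adjForm w w + adjForm w δ) + (adjForm δ w + adjForm δ δ)
      ≡⟨ cong₂ _+_ (cong (adjForm w w +_) wδ) (cong₂ _+_ (adjForm-𝟙⁅⁆ u w) δδ) ⟩
    (adjForm w w + N u) + (N u + 0)
      ≡⟨ +-assoc (adjForm w w) (N u) (N u + 0) ⟩
    adjForm w w + 2 * N u
      ∎
    where
    open ≡-Reasoning
    δ w⁺ N : Fin n → ℕ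
    δ = 𝟙 ⁅ u ⁆
    w⁺ i = w i + δ i
    N = neighbourSum w
    wδ : adjForm w δ ≡ N u
    wδ = trans (adjForm-comm w δ) (adjForm-𝟙⁅⁆ u w)
    δδ : adjForm δ δ ≡ 0
    δδ = trans (adjForm-𝟙⁅⁆ u δ) (trans (neighbourSum-𝟙⁅⁆ u u) (cong χ (adj-irrefl G u)))

  degIn : Subset n → Fin n → ℕ
  degIn S = neighbourSum (𝟙 S)

  -- The ordered adjacent pairs in S × T: an edge inside S counts twice in arcs S S.
  arcs : Subset n → Subset n → ℕ
  arcs S T = adjForm (𝟙 S) (𝟙 T)

  arcs-comm : (S T : Subset n) → arcs S T ≡ arcs T S
  arcs-comm S T = adjForm-comm (𝟙 S) (𝟙 T)

  arcs-mono : {S S′ T T′ : Subset n} → S ⊆ S′ → T ⊆ T′ → arcs S T ≤ arcs S′ T′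
  arcs-mono S⊆S′ T⊆T′ = adjForm-mono (𝟙-mono S⊆S′) (𝟙-mono T⊆T′)

  arcs-∪⁅⁆ : {S : Subset n} {u : Fin n} → u ∉ S →
             arcs (S ∪ ⁅ u ⁆) (S ∪ ⁅ u ⁆) ≡ arcs S S + 2 * degIn S u
  arcs-∪⁅⁆ {S} {u} u∉S = trans (adjForm-cong (𝟙-∪⁅⁆ u∉S)) (adjForm-+𝟙⁅⁆ (𝟙 S) u)

  degIn≤∣∣ : (S : Subset n) (v : Fin n) → degIn S v ≤ ∣ S ∣
  degIn≤∣∣ S v = ≤-trans (neighbourSum≤sum (𝟙 S) v) (≤-reflexive (sym (∣∣≡sum𝟙 S)))

  arcs≤ : (S T : Subset n) {c : ℕ} → (∀ v → degIn T v ≤ c) → arcs S T ≤ c * ∣ S ∣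
  arcs≤ S T {c} degT≤c =
    ≤-trans (sum-mono-≤ λ i → *-monoʳ-≤ (𝟙 S i) (degT≤c i)) (≤-reflexive (sum𝟙-* S c))

  degree≡neighbourSum1 : (v : Fin n) → degree G v ≡ neighbourSum (λ _ → 1) v
  degree≡neighbourSum1 v = sum-cong-≗ λ j → sym (*-identityʳ (χadj v j))

  degIn≤degree : (S : Subset n) (v : Fin n) → degIn S v ≤ degree G v
  degIn≤degree S v =
    ≤-trans (neighbourSum-mono (𝟙≤1 S) v) (≤-reflexive (sym (degree≡neighbourSum1 v)))

  degIn-∁ : (X : Subset n) (v : Fin n) → degIn (∁ X) v + degIn X v ≡ degree G v
  degIn-∁ X v = begin
    degIn (∁ X) v + degIn X v                   ≡⟨ neighbourSum-+ (𝟙 (∁ X)) (𝟙 X) v ⟨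
    neighbourSum (λ j → 𝟙 (∁ X) j + 𝟙 X j) v    ≡⟨ neighbourSum-cong (𝟙-∁ X) v ⟩
    neighbourSum (λ _ → 1) v                    ≡⟨ degree≡neighbourSum1 v ⟨
    degree G v                                  ∎
    where open ≡-Reasoning

  arcTerm≡1 : {S : Subset n} {v w : Fin n} → Adj G v w → w ∈ S → χadj v w * 𝟙 S w ≡ 1
  arcTerm≡1 vw w∈S rewrite vw | 𝟙-∈ w∈S = refl

  arcTerm≤1 : (S : Subset n) (v w : Fin n) → χadj v w * 𝟙 S w ≤ 1
  arcTerm≤1 S v w = *-mono-≤ (χ≤1 (adj G v w)) (𝟙≤1 S w)

  arcTerm-pos : (S : Subset n) (v w : Fin n) → 1 ≤ χadj v w * 𝟙 S w → Adj G v w × w ∈ S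
  arcTerm-pos S v w 1≤ with adj G v w in vw | lookup S w in Sw
  ... | true  | true  = refl , lookup⇒[]= w S Sw
  ... | true  | false = contradiction 1≤ λ ()
  ... | false | _     = contradiction 1≤ λ ()

  adj⇒1≤degIn : {S : Subset n} {v w : Fin n} → Adj G v w → w ∈ S → 1 ≤ degIn S v
  adj⇒1≤degIn {S} {v} {w} vw w∈S =
    subst (_≤ degIn S v) (arcTerm≡1 vw w∈S) (≤-sum (λ j → χadj v j * 𝟙 S j) w)

  adj≢⇒2≤degIn : {S : Subset n} {v w w′ : Fin n} → w ≢ w′ →
                 Adj G v w → Adj G v w′ → w ∈ S → w′ ∈ S → 2 ≤ degIn S v
  adj≢⇒2≤degIn {S} {v} w≢w′ vw vw′ w∈S w′∈S =
    subst (_≤ degIn S v) (cong₂ _+_ (arcTerm≡1 vw w∈S) (arcTerm≡1 vw′ w′∈S))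
          (+-≤-sum (λ j → χadj v j * 𝟙 S j) w≢w′)

  1≤degIn⇒adj : {S : Subset n} {v : Fin n} → 1 ≤ degIn S v → ∃ λ w → Adj G v w × w ∈ S
  1≤degIn⇒adj {S} {v} 1≤d with ∃-support (λ j → χadj v j * 𝟙 S j) 1≤d
  ... | w , 1≤t = w , arcTerm-pos S v w 1≤t

  2≤degIn⇒adj≢ : {S : Subset n} {v : Fin n} → 2 ≤ degIn S v →
                 (p : Fin n) → ∃ λ w → w ≢ p × Adj G v w × w ∈ S
  2≤degIn⇒adj≢ {S} {v} 2≤d p with ∃-≢-support (λ j → χadj v j * 𝟙 S j) (arcTerm≤1 S v) 2≤d p
  ... | w , w≢p , 1≤t = w , w≢p , arcTerm-pos S v w 1≤t

-- Walks and cycles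

module _ (G : Graph n) where

  Adj-sym : {i j : Fin n} → Adj G i j → Adj G j i
  Adj-sym {i} {j} ij = trans (adj-sym G j i) ij

  Adj⇒≢ : {i j : Fin n} → Adj G i j → i ≢ j
  Adj⇒≢ {i} ij refl = contradiction (trans (sym ij) (adj-irrefl G i)) λ ()

  Chain-snoc : {x y z : Fin n} (xs : List (Fin n)) →
               Chain G (x ∷ xs) → Last (x ∷ xs) z → Adj G z y → Chain G (x ∷ xs ++ y ∷ [])
  Chain-snoc []       _         (last-here _)  zy = zy , tt
  Chain-snoc []       _         (last-there ()) _
  Chain-snoc (w ∷ xs) (xw , ch) (last-there l) zy = xw , Chain-snoc xs ch l zy

  Chain-prefix : {x y : Fin n} {xs : List (Fin n)} (q : x ∈ˡ xs) →
                 Chain G (y ∷ xs) → Chain G (y ∷ prefix q)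
  Chain-prefix (here refl) (yx , _)  = yx , tt
  Chain-prefix (there q)   (yx , ch) = yx , Chain-prefix q ch

  walk-mono : {S S′ : Subset n} → S ⊆ S′ → {u v : Fin n} → WalkIn G S u v → WalkIn G S′ u v
  walk-mono S⊆S′ (ws , ch , l , ∈S) = ws , ch , l , All.map S⊆S′ ∈S

  walk-cons : {S : Subset n} {u v w : Fin n} → Adj G u v → u ∈ S → WalkIn G S v w → WalkIn G S u w
  walk-cons {v = v} uv u∈S (ws , ch , l , ∈S) = v ∷ ws , (uv , ch) , last-there l , u∈S ∷ ∈S

  walk-snoc : {S : Subset n} {u v w : Fin n} → WalkIn G S u v → Adj G v w → w ∈ S → WalkIn G S u w
  walk-snoc {u = u} {w = w} (ws , ch , l , ∈S) vw w∈S =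
    ws ++ w ∷ [] , Chain-snoc ws ch l vw , Last-snoc u ws w , All.++⁺ ∈S (w∈S ∷ [])

  walk-crossing : {S R : Subset n} {u v : Fin n} → WalkIn G S u v → u ∈ R → v ∉ R →
                  ∃₂ λ a b → Adj G a b × a ∈ R × b ∉ R × b ∈ S
  walk-crossing {S} {R} (ws , ch , l , ∈S) = crossing ws ch l ∈S
    where
    crossing : {u v : Fin n} (ws : List (Fin n)) →
               Chain G (u ∷ ws) → Last (u ∷ ws) v → All (_∈ S) (u ∷ ws) → u ∈ R → v ∉ R →
               ∃₂ λ a b → Adj G a b × a ∈ R × b ∉ R × b ∈ S
    crossing []       _         (last-here _)   _              u∈R v∉R = contradiction u∈R v∉R
    crossing []       _         (last-there ()) _              _   _
    crossing (b ∷ ws) (ub , ch) (last-there l)  (_ ∷ b∈S ∷ ∈S) u∈R v∉R with b ∈? R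
    ... | yes b∈R = crossing ws ch l (b∈S ∷ ∈S) b∈R v∉R
    ... | no  b∉R = _ , _ , ub , u∈R , b∉R , b∈S

  cycle⊆ : {S : Subset n} {c : List (Fin n)} → CycleIn G S c → All (_∈ S) c
  cycle⊆ {c = _ ∷ _} (_ , _ , ∈S , _) = ∈S

  cycle-within : {S S′ : Subset n} {c : List (Fin n)} →
                 All (_∈ S′) c → CycleIn G S c → CycleIn G S′ c
  cycle-within {c = _ ∷ _} ∈S′ (len , u , _ , ch , closing) = len , u , ∈S′ , ch , closing

  acyclic-mono : {S S′ : Subset n} → S′ ⊆ S → AcyclicIn G S → AcyclicIn G S′
  acyclic-mono S′⊆S acyclic c cyc = acyclic c (cycle-within (All.map S′⊆S (cycle⊆ cyc)) cyc)

  cycle-rotate : {S : Subset n} (x : Fin n) (xs : List (Fin n)) →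
                 CycleIn G S (x ∷ xs) → CycleIn G S (xs ++ x ∷ [])
  cycle-rotate x []       (s≤s () , _)
  cycle-rotate x (y ∷ xs) (len , (x∉ ∷ u) , (x∈S ∷ ∈S) , (xy , ch) , z , l , zx) =
    len′ , Unique.++⁺ u ([] ∷ []) disjoint , All.++⁺ ∈S (x∈S ∷ []) ,
    Chain-snoc xs ch (Last-tail l) zx , x , Last-snoc y xs x , xy
    where
    len′ : 3 ≤ length (y ∷ xs ++ x ∷ [])
    len′ = subst (3 ≤_) (cong suc (trans (+-comm 1 (length xs)) (sym (List.length-++ xs)))) len
    disjoint : Disjoint (y ∷ xs) (x ∷ [])
    disjoint (v∈ , here refl) = All.lookup x∉ v∈ refl

  cycle-rotate-to : {S : Subset n} (ys : List (Fin n)) (x : Fin n) (zs : List (Fin n)) →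
                    CycleIn G S (ys ++ x ∷ zs) → CycleIn G S (x ∷ zs ++ ys)
  cycle-rotate-to {S} []       x zs cyc =
    subst (CycleIn G S) (cong (x ∷_) (sym (List.++-identityʳ zs))) cyc
  cycle-rotate-to {S} (y ∷ ys) x zs cyc =
    subst (CycleIn G S) (cong (x ∷_) (List.++-assoc zs (y ∷ []) ys))
      (cycle-rotate-to ys x (zs ++ y ∷ [])
        (subst (CycleIn G S) (List.++-assoc ys (x ∷ zs) (y ∷ []))
          (cycle-rotate y (ys ++ x ∷ zs) cyc)))

  cycle-head-neighbours : {S : Subset n} {x : Fin n} {xs : List (Fin n)} → CycleIn G S (x ∷ xs) →
                          ∃₂ λ a b → a ≢ b × Adj G x a × Adj G x b × a ∈ S × b ∈ S
  cycle-head-neighbours {xs = []}         (s≤s () , _)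
  cycle-head-neighbours {xs = _ ∷ []}     (s≤s (s≤s ()) , _)
  cycle-head-neighbours {xs = a ∷ _ ∷ _}
                        (_ , (_ ∷ a∉ ∷ _) , (_ ∷ a∈S ∷ ∈S) , (xa , _) , y , l , yx) =
    a , y , All.lookup a∉ y∈ , xa , Adj-sym yx , a∈S , All.lookup ∈S y∈
    where
    y∈ : y ∈ˡ _ ∷ _
    y∈ = Last⇒∈ (Last-tail (Last-tail l))

  cycle-neighbours : {S : Subset n} {x : Fin n} {c : List (Fin n)} → x ∈ˡ c → CycleIn G S c →
                     ∃₂ λ a b → a ≢ b × Adj G x a × Adj G x b × a ∈ S × b ∈ S
  cycle-neighbours x∈c cyc with ∈-∃++ x∈c
  ... | ys , zs , refl = cycle-head-neighbours (cycle-rotate-to ys _ zs cyc)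

  close-cycle : {S : Subset n} {h p x : Fin n} {l : List (Fin n)} (q : x ∈ˡ l) → Adj G h x →
                Unique (h ∷ p ∷ l) → All (_∈ S) (h ∷ p ∷ l) → Chain G (h ∷ p ∷ l) →
                CycleIn G S (h ∷ p ∷ prefix q)
  close-cycle {x = x} q hx ((h≢p ∷ h∉l) ∷ (p∉l ∷ u)) (h∈S ∷ p∈S ∷ ∈S) (hp , ch) =
    s≤s (s≤s (1≤length-prefix q)) ,
    ((h≢p ∷ All-prefix q h∉l) ∷ (All-prefix q p∉l ∷ Unique-prefix q u)) ,
    h∈S ∷ p∈S ∷ All-prefix q ∈S ,
    (hp , Chain-prefix q ch) ,
    x , last-there (last-there (Last-prefix q)) , Adj-sym hx

  module _ {S : Subset n} (acyclic : AcyclicIn G S) (deg≥2 : ∀ v → v ∈ S → 2 ≤ degIn G S v) where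

    -- h ∷ p ∷ l is a path listed from its growing end; as no vertex is a leaf it grows without
    -- closing a cycle, until it would have more than n vertices.
    grow-path : ∀ d h p l → n < d + length (h ∷ p ∷ l) →
               Unique (h ∷ p ∷ l) → All (_∈ S) (h ∷ p ∷ l) → Chain G (h ∷ p ∷ l) → ⊥
    grow-path zero    h p l n< u _ _ = <⇒≱ n< (Unique⇒length≤ u)
    grow-path (suc d) h p l n< u path∈S@(h∈S ∷ _) ch with 2≤degIn⇒adj≢ G (deg≥2 h h∈S) p
    ... | x , x≢p , hx , x∈S with Any.any? (x ≟_) l
    ... | yes x∈l = acyclic _ (close-cycle x∈l hx u path∈S ch)
    ... | no  x∉l = grow-path d x h (p ∷ l) (subst (n <_) (sym (+-suc d _)) n<)
                      (x∉path ∷ u) (x∈S ∷ path∈S) (Adj-sym hx , ch)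
      where
      x∉path : All (x ≢_) (h ∷ p ∷ l)
      x∉path = Adj⇒≢ (Adj-sym hx) ∷ x≢p ∷ All.¬Any⇒All¬ l x∉l

  acyclic⇒leaf : {S : Subset n} → AcyclicIn G S → Nonempty S → ∃ λ v → v ∈ S × degIn G S v ≤ 1
  acyclic⇒leaf {S} acyclic (u , u∈S) with any? (λ v → v ∈? S ×-dec degIn G S v ≤? 1)
  ... | yes leaf = leaf
  ... | no  none = ⊥-elim (noLeaf (2≤degIn⇒adj≢ G (deg≥2 u u∈S) u))
    where
    deg≥2 : ∀ v → v ∈ S → 2 ≤ degIn G S v
    deg≥2 v v∈S = ≰⇒> λ d≤1 → none (v , v∈S , d≤1)
    noLeaf : (∃ λ x → x ≢ u × Adj G u x × x ∈ S) → ⊥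
    noLeaf (x , x≢u , ux , x∈S) =
      grow-path acyclic deg≥2 n x u [] (m<m+n n (s≤s z≤n))
        ((x≢u ∷ []) ∷ [] ∷ []) (x∈S ∷ u∈S ∷ []) (Adj-sym ux , tt)

-- Forests and trees

module _ (G : Graph n) where

  -- Removing a leaf u of S deletes the 2 * degIn (S - u) u ≤ 2 arcs at u.
  arcs-acyclic : {S : Subset n} → AcyclicIn G S → arcs G S S ≤ 2 * ∣ S ∣ ∸ 2
  arcs-acyclic {S} = bound ∣ S ∣ refl
    where
    bound : ∀ m {S} → ∣ S ∣ ≡ m → AcyclicIn G S → arcs G S S ≤ 2 * m ∸ 2
    bound zero    {S} ∣S∣≡0 _ = subst (λ m → arcs G S S ≤ m * m) ∣S∣≡0 (arcs≤ G S S (degIn≤∣∣ G S))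
    bound (suc m) {S} ∣S∣≡1+m acyclic with acyclic⇒leaf G acyclic (nonempty (subst (1 ≤_) (sym ∣S∣≡1+m) (s≤s z≤n)))
    ... | u , u∈S , leaf = subst (_≤ 2 * suc m ∸ 2) (sym arcs≡)
          (leaf-removal-bound m (bound m ∣S-u∣≡m (acyclic-mono G S-u⊆S acyclic))
            (≤-trans (neighbourSum-mono G (𝟙-mono S-u⊆S) u) leaf)
            (subst (degIn G (S - u) u ≤_) ∣S-u∣≡m (degIn≤∣∣ G (S - u) u)))
      where
      S-u⊆S : S - u ⊆ S
      S-u⊆S = p─q⊆p S ⁅ u ⁆
      ∣S-u∣≡m : ∣ S - u ∣ ≡ m
      ∣S-u∣≡m = suc-injective (trans (suc∣p-x∣≡∣p∣ u∈S) ∣S∣≡1+m)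
      arcs≡ : arcs G S S ≡ arcs G (S - u) (S - u) + 2 * degIn G (S - u) u
      arcs≡ = subst (λ S′ → arcs G S′ S′ ≡ arcs G (S - u) (S - u) + 2 * degIn G (S - u) u)
                    (p-x∪⁅x⁆≡p u∈S) (arcs-∪⁅⁆ G (x∉p-x S u))

  -- Growing R inside S along crossing edges adds at least two arcs per new vertex.
  arcs-grow : {S : Subset n} → (∀ u v → u ∈ S → v ∈ S → WalkIn G S u v) →
              ∀ f {R} → R ⊆ S → Nonempty R → ∣ S ∣ ≡ ∣ R ∣ + f → arcs G R R + 2 * f ≤ arcs G S S
  arcs-grow walk zero    {R} R⊆S _ _ = ≤-trans (≤-reflexive (+-identityʳ _)) (arcs-mono G R⊆S R⊆S)
  arcs-grow {S} walk (suc f) {R} R⊆S (w , w∈R) ∣S∣≡∣R∣+1+f with any? (λ v → v ∈? S ×-dec ¬? (v ∈? R))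
  ... | no  none = contradiction (p⊆q⇒∣p∣≤∣q∣ S⊆R) (<⇒≱ ∣R∣<∣S∣)
    where
    S⊆R : S ⊆ R
    S⊆R {v} v∈S with v ∈? R
    ... | yes v∈R = v∈R
    ... | no  v∉R = contradiction (v , v∈S , v∉R) none
    ∣R∣<∣S∣ : ∣ R ∣ < ∣ S ∣
    ∣R∣<∣S∣ = subst (∣ R ∣ <_) (sym ∣S∣≡∣R∣+1+f) (m<m+n ∣ R ∣ (s≤s z≤n))
  ... | yes (v , v∈S , v∉R) with walk-crossing G (walk w v (R⊆S w∈R) v∈S) w∈R v∉R
  ... | a , b , ab , a∈R , b∉R , b∈S = begin
    arcs G R R + 2 * suc f                ≡⟨ cong (arcs G R R +_) (*-suc 2 f) ⟩
    arcs G R R + (2 + 2 * f)              ≡⟨ +-assoc (arcs G R R) 2 (2 * f) ⟨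
    arcs G R R + 2 + 2 * f                ≤⟨ +-monoˡ-≤ (2 * f) (+-monoʳ-≤ (arcs G R R) 2≤2degIn) ⟩
    arcs G R R + 2 * degIn G R b + 2 * f  ≡⟨ cong (_+ 2 * f) (arcs-∪⁅⁆ G b∉R) ⟨
    arcs G R′ R′ + 2 * f                  ≤⟨ arcs-grow walk f R′⊆S (w , x∈p∪q⁺ (inj₁ w∈R)) ∣S∣≡∣R′∣+f ⟩
    arcs G S S                            ∎
    where
    open ≤-Reasoning
    R′ : Subset n
    R′ = R ∪ ⁅ b ⁆
    R′⊆S : R′ ⊆ S
    R′⊆S x∈R′ with ∈∪⁅⁆⁻ R x∈R′
    ... | inj₁ x∈R  = R⊆S x∈R
    ... | inj₂ refl = b∈S
    2≤2degIn : 2 ≤ 2 * degIn G R b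
    2≤2degIn = *-monoʳ-≤ 2 (adj⇒1≤degIn G (Adj-sym G ab) a∈R)
    ∣S∣≡∣R′∣+f : ∣ S ∣ ≡ ∣ R′ ∣ + f
    ∣S∣≡∣R′∣+f = trans ∣S∣≡∣R∣+1+f (trans (+-suc ∣ R ∣ f) (cong (_+ f) (sym (∣∪⁅⁆∣ b∉R))))

  arcs-connected : {S : Subset n} → ConnectedIn G S → 2 * ∣ S ∣ ≤ arcs G S S + 2
  arcs-connected {S} ((w , w∈S) , walk) = begin
    2 * ∣ S ∣                         ≡⟨ cong (2 *_) (sym (suc∣p-x∣≡∣p∣ w∈S)) ⟩
    2 * suc f                         ≡⟨ *-suc 2 f ⟩
    2 + 2 * f                         ≤⟨ +-monoʳ-≤ 2 (m≤n+m (2 * f) (arcs G ⁅ w ⁆ ⁅ w ⁆)) ⟩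
    2 + (arcs G ⁅ w ⁆ ⁅ w ⁆ + 2 * f)  ≤⟨ +-monoʳ-≤ 2 (arcs-grow walk f ⁅w⁆⊆S (w , x∈⁅x⁆ w) ∣S∣≡1+f) ⟩
    2 + arcs G S S                    ≡⟨ +-comm 2 (arcs G S S) ⟩
    arcs G S S + 2                    ∎
    where
    open ≤-Reasoning
    f : ℕ
    f = ∣ S - w ∣
    ∣S∣≡1+f : ∣ S ∣ ≡ ∣ ⁅ w ⁆ ∣ + f
    ∣S∣≡1+f = trans (sym (suc∣p-x∣≡∣p∣ w∈S)) (cong (_+ f) (sym (∣⁅x⁆∣≡1 w)))
    ⁅w⁆⊆S : ⁅ w ⁆ ⊆ S
    ⁅w⁆⊆S x∈⁅w⁆ rewrite x∈⁅y⁆⇒x≡y w x∈⁅w⁆ = w∈S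

  connected-∪-pendant : {T : Subset n} {a b : Fin n} → ConnectedIn G T → Adj G a b → b ∈ T →
                        ConnectedIn G (T ∪ ⁅ a ⁆)
  connected-∪-pendant {T} {a} {b} (_ , walkT) ab b∈T = (a , a∈U) , walkU
    where
    U : Subset n
    U = T ∪ ⁅ a ⁆
    T⊆U : T ⊆ U
    T⊆U x∈T = x∈p∪q⁺ (inj₁ x∈T)
    a∈U : a ∈ U
    a∈U = x∈p∪q⁺ (inj₂ (x∈⁅x⁆ a))
    walkU : ∀ u v → u ∈ U → v ∈ U → WalkIn G U u v
    walkU u v u∈U v∈U with ∈∪⁅⁆⁻ T u∈U | ∈∪⁅⁆⁻ T v∈U
    ... | inj₁ u∈T  | inj₁ v∈T  = walk-mono G T⊆U (walkT u v u∈T v∈T)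
    ... | inj₁ u∈T  | inj₂ refl = walk-snoc G (walk-mono G T⊆U (walkT u b u∈T b∈T)) (Adj-sym G ab) a∈U
    ... | inj₂ refl | inj₁ v∈T  = walk-cons G ab a∈U (walk-mono G T⊆U (walkT b v b∈T v∈T))
    ... | inj₂ refl | inj₂ refl = [] , tt , last-here a , a∈U ∷ []

  -- A cycle through a would provide two neighbours of a in T.
  acyclic-∪-pendant : {T : Subset n} {a : Fin n} → AcyclicIn G T → degIn G T a ≤ 1 →
                      AcyclicIn G (T ∪ ⁅ a ⁆)
  acyclic-∪-pendant {T} {a} acyclicT deg≤1 c cyc with Any.any? (a ≟_) c
  ... | yes a∈c with cycle-neighbours G a∈c cyc
  ...   | x , y , x≢y , ax , ay , x∈U , y∈U =
    contradiction (≤-trans (adj≢⇒2≤degIn G x≢y ax ay (neighbour∈T ax x∈U) (neighbour∈T ay y∈U)) deg≤1)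
                  λ { (s≤s ()) }
    where
    neighbour∈T : ∀ {x} → Adj G a x → x ∈ T ∪ ⁅ a ⁆ → x ∈ T
    neighbour∈T ax x∈U with ∈∪⁅⁆⁻ T x∈U
    ... | inj₁ x∈T  = x∈T
    ... | inj₂ refl = contradiction refl (Adj⇒≢ G ax)
  acyclic-∪-pendant {T} {a} acyclicT _ c cyc | no a∉c =
    acyclicT c (cycle-within G (All.map avoid (All.zip (cycle⊆ G cyc , All.¬Any⇒All¬ c a∉c))) cyc)
    where
    avoid : ∀ {x} → x ∈ T ∪ ⁅ a ⁆ × a ≢ x → x ∈ T
    avoid (x∈U , a≢x) with ∈∪⁅⁆⁻ T x∈U
    ... | inj₁ x∈T  = x∈T
    ... | inj₂ refl = contradiction refl a≢x

  tree-∪-pendant : {T : Subset n} {a : Fin n} → TreeIn G T → degIn G T a ≡ 1 → TreeIn G (T ∪ ⁅ a ⁆)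
  tree-∪-pendant {T} (connectedT , acyclicT) deg≡1 with 1≤degIn⇒adj G {T} (≤-reflexive (sym deg≡1))
  ... | b , ab , b∈T = connected-∪-pendant connectedT ab b∈T , acyclic-∪-pendant acyclicT (≤-reflexive deg≡1)

  module _ {r : ℕ} (deg≡r : ∀ v → degree G v ≡ r) where

    arcs-∁-regular : (S X : Subset n) → arcs G S (∁ X) + arcs G S X ≡ r * ∣ S ∣
    arcs-∁-regular S X = begin
      arcs G S (∁ X) + arcs G S X
        ≡⟨ ∑-distrib-+ (λ i → 𝟙 S i * degIn G (∁ X) i) (λ i → 𝟙 S i * degIn G X i) ⟨
      sum (λ i → 𝟙 S i * degIn G (∁ X) i + 𝟙 S i * degIn G X i)
        ≡⟨ sum-cong-≗ (λ i → trans (sym (*-distribˡ-+ (𝟙 S i) _ _)) (cong (𝟙 S i *_) (trans (degIn-∁ G X i) (deg≡r i)))) ⟩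
      sum (λ i → 𝟙 S i * r)
        ≡⟨ sum𝟙-* S r ⟩
      r * ∣ S ∣
        ∎
      where open ≡-Reasoning

    arcs≤regular : (S T : Subset n) → arcs G S T ≤ r * ∣ S ∣
    arcs≤regular S T = arcs≤ G S T λ v → subst (degIn G T v ≤_) (deg≡r v) (degIn≤degree G T v)

-- Regular apex trees

MinimalApexSet : Graph n → Subset n → Set
MinimalApexSet G X = ∀ Y → ∣ Y ∣ < ∣ X ∣ → ¬ DeleteIsTree G Y

module _ (G : Graph n) {X : Subset n} (tree : DeleteIsTree G X) where

  pendant-deletion : (a : Fin n) → degIn G (∁ X) a ≡ 1 → DeleteIsTree G (X - a)
  pendant-deletion a deg≡1 = subst (TreeIn G) (sym (∁[p-x]≡∁p∪⁅x⁆ X a)) (tree-∪-pendant G tree deg≡1)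

  boundary-vertex : Connected G → Nonempty X → ∃ λ a → a ∈ X × 1 ≤ degIn G (∁ X) a
  boundary-vertex (_ , walk) (x , x∈X) with walk-crossing G (walk x v₀ ∈⊤ ∈⊤) x∈X (x∈∁p⇒x∉p v₀∈∁X)
    where
    v₀ : Fin n
    v₀ = proj₁ (proj₁ (proj₁ tree))
    v₀∈∁X : v₀ ∈ ∁ X
    v₀∈∁X = proj₂ (proj₁ (proj₁ tree))
  ... | a , b , ab , a∈X , b∉X , _ = a , a∈X , adj⇒1≤degIn G ab (x∉p⇒x∈∁p b∉X)

  regular-count : {r : ℕ} → (∀ v → degree G v ≡ r) → r * ∣ ∁ X ∣ ≤ 2 * ∣ ∁ X ∣ ∸ 2 + r * ∣ X ∣
  regular-count {r} deg≡r = begin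
    r * ∣ ∁ X ∣                          ≡⟨ arcs-∁-regular G deg≡r (∁ X) X ⟨
    arcs G (∁ X) (∁ X) + arcs G (∁ X) X  ≤⟨ +-mono-≤ (arcs-acyclic G (proj₂ tree)) arcs∁X-X ⟩
    2 * ∣ ∁ X ∣ ∸ 2 + r * ∣ X ∣          ∎
    where
    open ≤-Reasoning
    arcs∁X-X : arcs G (∁ X) X ≤ r * ∣ X ∣
    arcs∁X-X = subst (_≤ r * ∣ X ∣) (arcs-comm G X (∁ X)) (arcs≤regular G deg≡r X (∁ X))

  -- For r = 2 the tree G - X receives exactly two edges from X, here both from a; yet a walk
  -- from X - a to a leaves X - a along an edge into G - X, as a has no neighbour in X.
  two-regular-impossible : Connected G → (∀ v → degree G v ≡ 2) → 2 ≤ ∣ X ∣ →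
                           {a : Fin n} → a ∈ X → degIn G (∁ X) a ≡ 2 → ⊥
  two-regular-impossible (_ , walk) deg≡2 2≤∣X∣ {a} a∈X degT≡2
    with nonempty {p = X - a} (s≤s⁻¹ (subst (2 ≤_) (sym (suc∣p-x∣≡∣p∣ a∈X)) 2≤∣X∣))
  ... | z , z∈X-a with walk-crossing G (walk z a ∈⊤ ∈⊤) z∈X-a (x∉p-x X a)
  ... | p , q , pq , p∈X-a , q∉X-a , _ with q ≟ a
  ...   | yes refl = contradiction degX≡0 (m<n⇒n≢0 (adj⇒1≤degIn G (Adj-sym G pq) (p─q⊆p X ⁅ q ⁆ p∈X-a)))
    where
    degX≡0 : degIn G X q ≡ 0
    degX≡0 = +-cancelˡ-≡ 2 _ 0 (begin
      2 + degIn G X q              ≡⟨ cong (_+ degIn G X q) degT≡2 ⟨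
      degIn G (∁ X) q + degIn G X q ≡⟨ degIn-∁ G X q ⟩
      degree G q                   ≡⟨ deg≡2 q ⟩
      2                            ∎)
      where open ≡-Reasoning
  ...   | no  q≢a  = <⇒≱ 3≤arcs arcs≤2
    where
    T : Subset n
    T = ∁ X
    a≢p : a ≢ p
    a≢p refl = x∉p-x X a p∈X-a
    q∈T : q ∈ T
    q∈T = x∉p⇒x∈∁p λ q∈X → q∉X-a (x∈p∧x≢y⇒x∈p-y q∈X q≢a)
    𝟙X-* : ∀ {x} → x ∈ X → 𝟙 X x * degIn G T x ≡ degIn G T x
    𝟙X-* {x} x∈X = trans (cong (_* degIn G T x) (𝟙-∈ x∈X)) (*-identityˡ (degIn G T x))
    3≤arcs : 3 ≤ arcs G X T
    3≤arcs = begin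
      2 + 1                                      ≤⟨ +-mono-≤ (≤-reflexive (sym degT≡2)) (adj⇒1≤degIn G pq q∈T) ⟩
      degIn G T a + degIn G T p                  ≡⟨ cong₂ _+_ (𝟙X-* a∈X) (𝟙X-* (p─q⊆p X ⁅ a ⁆ p∈X-a)) ⟨
      𝟙 X a * degIn G T a + 𝟙 X p * degIn G T p  ≤⟨ +-≤-sum (λ i → 𝟙 X i * degIn G T i) a≢p ⟩
      arcs G X T                                 ∎
      where open ≤-Reasoning
    arcs≤2 : arcs G X T ≤ 2
    arcs≤2 = +-cancelˡ-≤ (arcs G T T) _ _ (begin
      arcs G T T + arcs G X T  ≡⟨ cong (arcs G T T +_) (arcs-comm G X T) ⟩
      arcs G T T + arcs G T X  ≡⟨ arcs-∁-regular G deg≡2 T X ⟩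
      2 * ∣ T ∣                ≤⟨ arcs-connected G (proj₁ tree) ⟩
      arcs G T T + 2           ∎)
      where open ≤-Reasoning

  low-degree-impossible : Connected G → MinimalApexSet G X → 2 ≤ ∣ X ∣ →
                          {r : ℕ} → (∀ v → degree G v ≡ r) → r ≤ 2 → ⊥
  low-degree-impossible connected minimal 2≤∣X∣ {r} deg≡r r≤2
    with boundary-vertex connected (nonempty (≤-trans (s≤s z≤n) 2≤∣X∣))
  ... | a , a∈X , 1≤degT = two-regular-impossible connected (λ v → trans (deg≡r v) r≡2) 2≤∣X∣ a∈X degT≡2
    where
    2≤degT : 2 ≤ degIn G (∁ X) a
    2≤degT = ≤∧≢⇒< 1≤degT λ 1≡degT →
      minimal (X - a) (≤-reflexive (suc∣p-x∣≡∣p∣ a∈X)) (pendant-deletion a (sym 1≡degT))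
    degT≤r : degIn G (∁ X) a ≤ r
    degT≤r = subst (degIn G (∁ X) a ≤_) (deg≡r a) (degIn≤degree G (∁ X) a)
    degT≡2 : degIn G (∁ X) a ≡ 2
    degT≡2 = ≤-antisym (≤-trans degT≤r r≤2) 2≤degT
    r≡2 : r ≡ 2
    r≡2 = ≤-antisym r≤2 (≤-trans 2≤degT degT≤r)

  regular-impossible : Connected G → MinimalApexSet G X → 2 ≤ ∣ X ∣ → 4 * ∣ X ∣ ∸ 1 ≤ n →
                       {r : ℕ} → (∀ v → degree G v ≡ r) → ⊥
  regular-impossible connected minimal 2≤∣X∣ bound {r} deg≡r with r ≤? 2
  ... | yes r≤2 = low-degree-impossible connected minimal 2≤∣X∣ deg≡r r≤2
  ... | no  r≰2 = regular-count-impossible (≰⇒> r≰2) 2≤∣X∣ bound′ (regular-count deg≡r)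
    where
    bound′ : 4 * ∣ X ∣ ∸ 1 ≤ ∣ ∁ X ∣ + ∣ X ∣
    bound′ = subst (4 * ∣ X ∣ ∸ 1 ≤_) (sym (∣∁p∣+∣p∣≡n X)) bound

mainTheorem1 : (k n : ℕ) → 2 ≤ k → 4 * k ∸ 1 ≤ n → (G : Graph n) → Connected G →
    IsKApexTree k G → ¬ Regular G
mainTheorem1 k n 2≤k bound G connected ((X , refl , tree) , minimal) regular =
  regular-impossible G tree connected minimal 2≤k bound (λ v → regular v (proj₁ (proj₁ (proj₁ tree))))
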